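{- Let $a,b\geq 3$ and let $m$ be an integer with $m\geq \min\{a,b\}-1$ and $m\geq 3$. Then $K_{a,b}^{1/m}$ is locatable.
   Context: $K_{a,b}$ is the complete bipartite graph with parts of sizes $a$ and $b$. For a graph $G$ and positive integer $m$, $G^{1/m}$ denotes the graph obtained from $G$ by replacing each edge by a path of length $m$ through $m-1$ new vertices. The Robber Locating game on a finite connected graph: a robber occupies an (initially unknown) vertex. In each round the robber first either stays or moves to an adjacent vertex, and then the cop probes any vertex $v$ and is told the current distance from $v$ to the robber; there is no further restriction on the robber's moves. The cop wins if at some point she can determine the robber's current vertex uniquely. The robber is omniscient. A graph is locatable if the cop has a strategy guaranteed to win within a bounded number of rounds, equivalently one that wins against every robber behaviour. -}

module Defs where

open import Data.Nat using (ℕ; zero; suc; _<_; _≤_; _∸_; s≤s; z≤n)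
open import Data.Nat.Properties using (_<?_)
open import Data.Fin using (Fin; fromℕ<)
open import Data.List using (List; map; upTo)
open import Data.Product using (Σ; _×_; _,_; ∃)
open import Data.Sum using (_⊎_)
open import Relation.Nullary using (¬_; yes; no)
open import Relation.Binary.PropositionalEquality using (_≡_)

-- Graphs (simple undirected graphs are given by a symmetric adjacency
-- relation on a vertex type).

record Graph : Set₁ where
  field
    V   : Set
    Adj : V → V → Set

open Graph public

data Walk (G : Graph) : V G → V G → ℕ → Set where
  nil  : ∀ {u} → Walk G u u 0
  cons : ∀ {u w v n} → Adj G u w → Walk G w v n → Walk G u v (suc n)

Dist : (G : Graph) → V G → V G → ℕ → Set
Dist G u v d = Walk G u v d × (∀ e → e < d → ¬ Walk G u v e)

-- Vertices: the a left vertices, the b right vertices, and for every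
-- edge (i , j) of K_{a,b} the m-1 internal vertices of its path,
-- mid i j t being at position (t+1) along the path from left i to right j.

data KVertex (a b m : ℕ) : Set where
  left  : Fin a → KVertex a b m
  right : Fin b → KVertex a b m
  mid   : Fin a → Fin b → Fin (m ∸ 1) → KVertex a b m

private
  lem : ∀ {k m} → suc k < m → k < m ∸ 1
  lem {m = suc m} (s≤s p) = p

-- the vertex at position k along the path replacing edge (i , j)
-- (position 0 is left i, positions ≥ m are right j)
pathVertex : ∀ {a b m} → Fin a → Fin b → ℕ → KVertex a b m
pathVertex i j zero = left i
pathVertex {m = m} i j (suc k) with suc k <? m
... | yes p = mid i j (fromℕ< (lem p))
... | no _  = right j

KAdj : ∀ a b m → KVertex a b m → KVertex a b m → Set
KAdj a b m u v =
  Σ (Fin a) λ i → Σ (Fin b) λ j → Σ ℕ λ k → k < m ×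
    ((u ≡ pathVertex i j k × v ≡ pathVertex i j (suc k)) ⊎
     (v ≡ pathVertex i j k × u ≡ pathVertex i j (suc k)))

KSub : ℕ → ℕ → ℕ → Graph
KSub a b m = record { V = KVertex a b m ; Adj = KAdj a b m }

-- A (deterministic) cop strategy: given the list of answers received so
-- far (oldest first), choose the vertex to probe next.
Strategy : Graph → Set
Strategy G = List ℕ → V G

-- A robber trajectory: r i is the robber's position in round i (after
-- its move in that round); between rounds it stays or moves to a
-- neighbour.  The initial position is arbitrary.
RobberWalk : (G : Graph) → (ℕ → V G) → Set
RobberWalk G r = ∀ i → (r (suc i) ≡ r i) ⊎ Adj G (r i) (r (suc i))

history : (ℕ → ℕ) → ℕ → List ℕ
history d i = map d (upTo i)

Play : (G : Graph) → Strategy G → (ℕ → V G) → (ℕ → ℕ) → Set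
Play G σ r d = RobberWalk G r × (∀ i → Dist G (σ (history d i)) (r i) (d i))

-- After round k the cop knows the robber's position: every play against
-- σ with the same answers in rounds 0..k has the robber at the same
-- vertex in round k.
Located : (G : Graph) → Strategy G → (ℕ → V G) → (ℕ → ℕ) → ℕ → Set
Located G σ r d k =
  ∀ r' d' → Play G σ r' d' → (∀ i → i ≤ k → d' i ≡ d i) → r' k ≡ r k

Locatable : Graph → Set
Locatable G =
  Σ (Strategy G) λ σ → Σ ℕ λ N →
    ∀ r d → Play G σ r d → Σ ℕ λ k → k ≤ N × Located G σ r d k

module Submission where

-- Every vertex sits at some position ("level") 0 … m on a path (i , j) from
-- left vertex i to right vertex j.  The cop has a finite memory: the robber's
-- last level and two searches that test candidates one at a time, first for
-- the left index i (probing left vertices), then for the right index j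
-- (probing right vertices); right after seeing the robber at a right vertex
-- it probes the vertex next to that one.  Every answer reveals the robber's
-- level and whether the tested index is the robber's.
--
-- The theorem follows
-- after exchanging the two sides if necessary.

open import Defs
open import Data.Nat using (ℕ; zero; suc; _+_; _*_; _∸_; _⊓_; _≤_; _<_; s≤s; z≤n; _≟_; _<?_; _≤?_; ∣_-_∣)
open import Data.Nat.Properties
open import Data.Fin as Fin using (Fin; toℕ; fromℕ<)
open import Data.Fin.Properties using (toℕ<n; toℕ-injective; toℕ-fromℕ<; fromℕ<-toℕ; opposite-prop; opposite-involutive) renaming (_≟_ to _≟ᶠ_)
open import Data.Bool using (Bool; true; false)
open import Data.List using (foldl; _∷ʳ_; applyUpTo)
open import Data.List.Properties using (foldl-∷ʳ; applyUpTo-∷ʳ; map-upTo)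
open import Data.Product using (Σ; _×_; _,_; proj₁; proj₂)
open import Data.Sum using (_⊎_; inj₁; inj₂)
open import Function using (_∘_)
open import Relation.Nullary using (¬_; Dec; yes; no; does; proof; contradiction)
open import Relation.Nullary.Reflects using (Reflects; ofʸ; ofⁿ)
open import Relation.Nullary.Decidable using (dec-true; _×-dec_; _→-dec_)
open import Relation.Binary.PropositionalEquality

module _ {G : Graph} where

  infixr 5 _++ᵂ_

  _++ᵂ_ : ∀ {u v w e e′} → Walk G u v e → Walk G v w e′ → Walk G u w (e + e′)
  nil      ++ᵂ q = q
  cons x p ++ᵂ q = cons x (p ++ᵂ q)

  reverseWalk : (∀ {u w} → Adj G u w → Adj G w u) →
                ∀ {u v e} → Walk G u v e → Walk G v u e
  reverseWalk symmetric nil = nil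
  reverseWalk symmetric {e = suc e} (cons x p) =
    subst (Walk G _ _) (+-comm e 1) (reverseWalk symmetric p ++ᵂ cons (symmetric x) nil)

  shorter : ∀ {u v e₁ e₂} → Walk G u v e₁ → Walk G u v e₂ → Walk G u v (e₁ ⊓ e₂)
  shorter {u} {v} {e₁} {e₂} w₁ w₂ with ⊓-sel e₁ e₂
  ... | inj₁ e₁⊓e₂≡e₁ = subst (Walk G u v) (sym e₁⊓e₂≡e₁) w₁
  ... | inj₂ e₁⊓e₂≡e₂ = subst (Walk G u v) (sym e₁⊓e₂≡e₂) w₂

  Lipschitz : (V G → ℕ) → Set
  Lipschitz f = ∀ {u w} → Adj G u w → f w ≤ suc (f u)

  walk-Lipschitz : ∀ {f} → Lipschitz f → ∀ {u v e} → Walk G u v e → f v ≤ f u + e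
  walk-Lipschitz {f} L {u} nil = ≤-reflexive (sym (+-identityʳ (f u)))
  walk-Lipschitz {f} L {u} (cons {n = e} x p) = begin
    f _             ≤⟨ walk-Lipschitz L p ⟩
    f _ + e         ≤⟨ +-monoˡ-≤ e (L x) ⟩
    suc (f u) + e   ≡⟨ sym (+-suc (f u) e) ⟩
    f u + suc e     ∎
    where open ≤-Reasoning

  distance-by-potential : ∀ {f p} → Lipschitz f → f p ≡ 0 → (∀ v → Walk G p v (f v)) →
                          ∀ {v e} → Dist G p v e → e ≡ f v
  distance-by-potential {f} {p} L fp≡0 reach {v} {e} (w , shortest) =
    ≤-antisym e≤fv (≤-trans (walk-Lipschitz L w) (≤-reflexive (cong (_+ e) fp≡0)))
    where
    e≤fv : e ≤ f v
    e≤fv with e ≤? f v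
    ... | yes e≤ = e≤
    ... | no e≰ = contradiction (reach v) (shortest (f v) (≰⇒> e≰))

mapWalk : ∀ {G H : Graph} (φ : V G → V H) → (∀ {u w} → Adj G u w → Adj H (φ u) (φ w)) →
          ∀ {u v e} → Walk G u v e → Walk H (φ u) (φ v) e
mapWalk φ adj nil = nil
mapWalk φ adj (cons x p) = cons (adj x) (mapWalk φ adj p)

record Isomorphism (G H : Graph) : Set where
  field
    to       : V G → V H
    from     : V H → V G
    from-to  : ∀ v → from (to v) ≡ v
    to-from  : ∀ v → to (from v) ≡ v
    to-adj   : ∀ {u w} → Adj G u w → Adj H (to u) (to w)
    from-adj : ∀ {u w} → Adj H u w → Adj G (from u) (from w)

module _ {G H : Graph} (iso : Isomorphism G H) where
  open Isomorphism iso

  to-dist : ∀ {u v e} → Dist G u v e → Dist H (to u) (to v) e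
  to-dist {u} {v} (w , shortest) =
    mapWalk to to-adj w ,
    λ e′ e′<e w′ → shortest e′ e′<e (subst₂ (λ x y → Walk G x y e′) (from-to u) (from-to v) (mapWalk from from-adj w′))

  -- A cop on G imitates a winning cop on H, translating probes back along `from`.
  locatable-transfer : Locatable H → Locatable G
  locatable-transfer (σ , N , wins) = σ′ , N , wins′
    where
    σ′ : Strategy G
    σ′ answers = from (σ answers)

    image : ∀ {r d} → Play G σ′ r d → Play H σ (λ i → to (r i)) d
    image {r} {d} (moves , dists) = (λ i → image-move (moves i)) , image-dist
      where
      image-move : ∀ {x y} → (y ≡ x) ⊎ Adj G x y → (to y ≡ to x) ⊎ Adj H (to x) (to y)
      image-move (inj₁ y≡x) = inj₁ (cong to y≡x)
      image-move (inj₂ x~y) = inj₂ (to-adj x~y)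
      image-dist : ∀ i → Dist H (σ (history d i)) (to (r i)) (d i)
      image-dist i = subst (λ z → Dist H z (to (r i)) (d i)) (to-from _) (to-dist (dists i))

    wins′ : ∀ r d → Play G σ′ r d → Σ ℕ λ k → k ≤ N × Located G σ′ r d k
    wins′ r d play with wins _ d (image play)
    ... | k , k≤N , located = k , k≤N , λ r′ d′ play′ agree → begin
      r′ k              ≡⟨ sym (from-to (r′ k)) ⟩
      from (to (r′ k))  ≡⟨ cong from (located _ d′ (image play′) agree) ⟩
      from (to (r k))   ≡⟨ from-to (r k) ⟩
      r k               ∎
      where open ≡-Reasoning

descent : (F : ℕ → Set) → (∀ t → Dec (F t)) → (φ : ℕ → ℕ) → ∀ t₀ →
          (∀ t → t₀ ≤ t → ¬ F t → F (suc t) ⊎ φ (suc t) < φ t) →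
          Σ ℕ λ w → w ≤ t₀ + suc (φ t₀) × F w
descent F F? φ t₀ advance = go (suc (φ t₀)) t₀ ≤-refl ≤-refl
  where
  go : ∀ fuel t → t₀ ≤ t → φ t < fuel → Σ ℕ λ w → w ≤ t + fuel × F w
  go zero t _ ()
  go (suc fuel) t t₀≤t φt<fuel with F? t
  ... | yes Ft = t , m≤m+n t (suc fuel) , Ft
  ... | no ¬Ft with advance t t₀≤t ¬Ft
  ...   | inj₁ Ft′ = suc t , ≤-trans (s≤s (m≤m+n t fuel)) (≤-reflexive (sym (+-suc t fuel))) , Ft′
  ...   | inj₂ dec with go fuel (suc t) (m≤n⇒m≤1+n t₀≤t) (≤-trans dec (≤-pred φt<fuel))
  ...     | w , w≤ , Fw = w , ≤-trans w≤ (≤-reflexive (sym (+-suc t fuel))) , Fw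

module Automaton {G : Graph} {State : Set}
                 (start : State) (step : State → ℕ → State) (probe : State → V G) where

  strategy : Strategy G
  strategy answers = probe (foldl step start answers)

  stateAt : (ℕ → ℕ) → ℕ → State
  stateAt d t = foldl step start (history d t)

  stateAt-suc : ∀ d t → stateAt d (suc t) ≡ step (stateAt d t) (d t)
  stateAt-suc d t = begin
    foldl step start (history d (suc t))        ≡⟨ cong (foldl step start) (map-upTo d (suc t)) ⟩
    foldl step start (applyUpTo d (suc t))      ≡⟨ cong (foldl step start) (sym (applyUpTo-∷ʳ d t)) ⟩
    foldl step start (applyUpTo d t ∷ʳ d t)     ≡⟨ foldl-∷ʳ step start (d t) (applyUpTo d t) ⟩
    step (foldl step start (applyUpTo d t)) (d t) ≡⟨ cong (λ l → step (foldl step start l) (d t)) (sym (map-upTo d t)) ⟩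
    step (stateAt d t) (d t)                    ∎
    where open ≡-Reasoning

  stateAt-agree : ∀ {d d′} t → (∀ i → i < t → d′ i ≡ d i) → stateAt d′ t ≡ stateAt d t
  stateAt-agree zero agree = refl
  stateAt-agree {d} {d′} (suc t) agree = begin
    stateAt d′ (suc t)         ≡⟨ stateAt-suc d′ t ⟩
    step (stateAt d′ t) (d′ t) ≡⟨ cong₂ step (stateAt-agree t (λ i i<t → agree i (m≤n⇒m≤1+n i<t))) (agree t ≤-refl) ⟩
    step (stateAt d t) (d t)   ≡⟨ sym (stateAt-suc d t) ⟩
    stateAt d (suc t)          ∎
    where open ≡-Reasoning

  -- Soundness of a knowledge invariant.  `Consistent q v` says that state q is
  -- compatible with the robber standing at v; `Carried q v′` is what q still
  -- guarantees after the robber has moved on to v′.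
  module Invariant (Consistent Carried : State → V G → Set)
                   (carried-start : ∀ v → Carried start v)
                   (carried-move : ∀ {q v v′} → Consistent q v → (v′ ≡ v) ⊎ Adj G v v′ → Carried q v′)
                   (round : ∀ {q v e} → Carried q v → Dist G (probe q) v e → Consistent (step q e) v) where

    consistent-play : ∀ {r d} → Play G strategy r d → ∀ t → Consistent (stateAt d (suc t)) (r t)
    consistent-play {r} {d} (moves , dists) zero =
      subst (λ q → Consistent q (r 0)) (sym (stateAt-suc d 0)) (round (carried-start (r 0)) (dists 0))
    consistent-play {r} {d} play@(moves , dists) (suc t) =
      subst (λ q → Consistent q (r (suc t))) (sym (stateAt-suc d (suc t)))
        (round (carried-move (consistent-play play t) (moves t)) (dists (suc t)))

    located : ∀ {r d} → Play G strategy r d → ∀ w →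
              (∀ {v v′} → Consistent (stateAt d (suc w)) v → Consistent (stateAt d (suc w)) v′ → v ≡ v′) →
              Located G strategy r d w
    located {r} {d} play w determined r′ d′ play′ agree =
      determined (subst (λ q → Consistent q (r′ w)) same-state (consistent-play play′ w)) (consistent-play play w)
      where
      same-state : stateAt d′ (suc w) ≡ stateAt d (suc w)
      same-state = stateAt-agree (suc w) (λ i i<1+w → agree i (≤-pred i<1+w))

-- Searching for an unknown index z : Fin (suc N) by asking "is z = p?" for
-- p = 0, 1, 2, …: the search either has found z or knows a lower bound for it.
data Search : Set where
  found   : ℕ → Search
  atLeast : ℕ → Search

current : Search → ℕ
current (found p)   = p
current (atLeast p) = p

Fits : ∀ {N} → Search → Fin (suc N) → Set
Fits (found p)   z = toℕ z ≡ p
Fits (atLeast p) z = p ≤ toℕ z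

-- number of candidates not yet excluded, besides the current one
remaining : ℕ → Search → ℕ
remaining N (found _)   = 0
remaining N (atLeast p) = N ∸ p

refine : Search → Bool → Search
refine c true  = found (current c)
refine c false = atLeast (suc (current c))

-- the index p as an element of Fin (suc N), truncated at N
clamp : (N : ℕ) → ℕ → Fin (suc N)
clamp N       zero    = Fin.zero
clamp zero    (suc p) = Fin.zero
clamp (suc N) (suc p) = Fin.suc (clamp N p)

clamp-toℕ : ∀ N p → p ≤ N → toℕ (clamp N p) ≡ p
clamp-toℕ N       zero    _         = refl
clamp-toℕ (suc N) (suc p) (s≤s p≤N) = cong suc (clamp-toℕ N p p≤N)

current≤ : ∀ {N} c {z : Fin (suc N)} → Fits c z → current c ≤ toℕ z
current≤ (found _)   z≡p = ≤-reflexive (sym z≡p)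
current≤ (atLeast _) p≤z = p≤z

toℕ-guess : ∀ {N} c {z : Fin (suc N)} → Fits c z → toℕ (clamp N (current c)) ≡ current c
toℕ-guess {N} c {z} fits = clamp-toℕ N (current c) (≤-trans (current≤ c fits) (≤-pred (toℕ<n z)))

refine-fits : ∀ {N} c {z : Fin (suc N)} {b} → Fits c z → Reflects (z ≡ clamp N (current c)) b → Fits (refine c b) z
refine-fits c fits (ofʸ z≡guess) = trans (cong toℕ z≡guess) (toℕ-guess c fits)
refine-fits c fits (ofⁿ z≢guess) =
  ≤∧≢⇒< (current≤ c fits) (λ current≡z → z≢guess (toℕ-injective (trans (sym current≡z) (sym (toℕ-guess c fits)))))

start-fits : ∀ {N} (z : Fin (suc N)) → Fits (atLeast 0) z
start-fits _ = z≤n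

remaining≤ : ∀ N c → remaining N c ≤ N
remaining≤ N (found _)   = z≤n
remaining≤ N (atLeast p) = m∸n≤m N p

refine-shrinks : ∀ N c b → remaining N c ≢ 0 → suc (remaining N (refine c b)) ≤ remaining N c
refine-shrinks N (found _)   b     unfinished = contradiction refl unfinished
refine-shrinks N (atLeast p) true  unfinished = n≢0⇒n>0 unfinished
refine-shrinks N (atLeast p) false unfinished = ≤-reflexive (sym (+-∸-assoc 1 {N} {suc p} (m∸n≢0⇒n<m unfinished)))

finished : ∀ {N} c {z z′ : Fin (suc N)} → remaining N c ≡ 0 → Fits c z → Fits c z′ → z ≡ z′
finished (found _) _ z≡p z′≡p = toℕ-injective (trans z≡p (sym z′≡p))
finished {N} (atLeast p) {z} {z′} none p≤z p≤z′ = toℕ-injective (trans (is-N p≤z) (sym (is-N p≤z′)))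
  where
  is-N : ∀ {y : Fin (suc N)} → p ≤ toℕ y → toℕ y ≡ N
  is-N {y} p≤y = ≤-antisym (≤-pred (toℕ<n y)) (≤-trans (m∸n≡0⇒m≤n none) p≤y)

_≈₁_ : ℕ → ℕ → Set
x ≈₁ y = y ≤ suc x × x ≤ suc y

ascending : ∀ c p → (c + p) ≈₁ (c + suc p)
ascending c p = ≤-reflexive (+-suc c p) , m≤n⇒m≤1+n (+-monoʳ-≤ c (n≤1+n p))

descending : ∀ c M p → p < M → (c + (M ∸ p)) ≈₁ (c + (M ∸ suc p))
descending c M p p<M =
  m≤n⇒m≤1+n (+-monoʳ-≤ c (∸-monoʳ-≤ M (n≤1+n p))) ,
  ≤-reflexive (trans (cong (c +_) (+-∸-assoc 1 p<M)) (+-suc c (M ∸ suc p)))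

distance-step : ∀ x p → ∣ x - p ∣ ≈₁ ∣ x - suc p ∣
distance-step zero    p       = ≤-refl , m≤n⇒m≤1+n (n≤1+n p)
distance-step (suc x) zero    = m≤n⇒m≤1+n (m≤n⇒m≤1+n (≤-reflexive x-0≡x)) , s≤s (≤-reflexive (sym x-0≡x))
  where
  x-0≡x : ∣ x - 0 ∣ ≡ x
  x-0≡x = m≤n⇒∣n-m∣≡n∸m z≤n
distance-step (suc x) (suc p) = distance-step x p

≈₁-⊓ : ∀ {x y x′ y′} → x ≈₁ y → x′ ≈₁ y′ → (x ⊓ x′) ≈₁ (y ⊓ y′)
≈₁-⊓ (y≤ , x≤) (y′≤ , x′≤) = ⊓-mono-≤ y≤ y′≤ , ⊓-mono-≤ x≤ x′≤

module Structure (a₁ b₁ k : ℕ) where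

  a b m : ℕ
  a = suc a₁
  b = suc b₁
  m = suc k

  G : Graph
  G = KSub a b m

  Vertex : Set
  Vertex = KVertex a b m

  pathAt : Fin a → Fin b → ℕ → Vertex
  pathAt = pathVertex

  level : Vertex → ℕ
  level (left _)    = 0
  level (right _)   = m
  level (mid _ _ t) = suc (toℕ t)

  -- the path indices of a vertex; the left index is meaningful below level m,
  -- the right index above level 0
  leftIndex : Vertex → Fin a
  leftIndex (left i)    = i
  leftIndex (right _)   = Fin.zero
  leftIndex (mid i _ _) = i

  rightIndex : Vertex → Fin b
  rightIndex (left _)    = Fin.zero
  rightIndex (right j)   = j
  rightIndex (mid _ j _) = j

  level≤m : ∀ v → level v ≤ m
  level≤m (left _)    = z≤n
  level≤m (right _)   = ≤-refl
  level≤m (mid _ _ t) = s≤s (<⇒≤ (toℕ<n t))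

  mid<m : ∀ (t : Fin k) → suc (toℕ t) < m
  mid<m t = s≤s (toℕ<n t)

  pathAt-right : ∀ i j → pathAt i j m ≡ right j
  pathAt-right i j with m <? m
  ... | yes m<m = contradiction m<m (<-irrefl refl)
  ... | no _    = refl

  pathAt-mid : ∀ i j (t : Fin k) → pathAt i j (suc (toℕ t)) ≡ mid i j t
  pathAt-mid i j t with suc (toℕ t) <? m
  ... | yes p = cong (mid i j) (fromℕ<-toℕ t _)
  ... | no ¬p = contradiction (mid<m t) ¬p

  pathAt-coordinates : ∀ i j p → p ≤ m →
    level (pathAt i j p) ≡ p × (p < m → leftIndex (pathAt i j p) ≡ i) × (0 < p → rightIndex (pathAt i j p) ≡ j)
  pathAt-coordinates i j zero _ = refl , (λ _ → refl) , λ ()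
  pathAt-coordinates i j (suc p) p≤m with suc p <? m
  ... | yes _  = cong suc (toℕ-fromℕ< _) , (λ _ → refl) , (λ _ → refl)
  ... | no p≮m = ≤-antisym (≮⇒≥ p≮m) p≤m , (λ p<m → contradiction p<m p≮m) , (λ _ → refl)

  canonical : ∀ v → pathAt (leftIndex v) (rightIndex v) (level v) ≡ v
  canonical (left i)    = refl
  canonical (right j)   = pathAt-right Fin.zero j
  canonical (mid i j t) = pathAt-mid i j t

  vertex-ext : ∀ {v v′} → level v ≡ level v′ →
               (level v < m → leftIndex v ≡ leftIndex v′) → (0 < level v → rightIndex v ≡ rightIndex v′) → v ≡ v′
  vertex-ext {left i}    {left i′}     _ same-i _      = cong left (same-i (s≤s z≤n))
  vertex-ext {right j}   {right j′}    _ _ same-j      = cong right (same-j (s≤s z≤n))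
  vertex-ext {mid i j t} {mid i′ j′ t′} e same-i same-j =
    cong₂ (λ (ij : Fin a × Fin b) t → mid (proj₁ ij) (proj₂ ij) t)
      (cong₂ _,_ (same-i (mid<m t)) (same-j (s≤s z≤n))) (toℕ-injective (suc-injective e))
  vertex-ext {right _}   {mid _ _ t′}  e _ _ = contradiction (sym e) (<⇒≢ (mid<m t′))
  vertex-ext {mid _ _ t} {right _}     e _ _ = contradiction e (<⇒≢ (mid<m t))
  vertex-ext {left _}    {right _}     ()
  vertex-ext {left _}    {mid _ _ _}   ()
  vertex-ext {right _}   {left _}      ()
  vertex-ext {mid _ _ _} {left _}      ()

  adj-sym : ∀ {u w} → Adj G u w → Adj G w u
  adj-sym (i , j , p , p<m , inj₁ ends) = i , j , p , p<m , inj₂ ends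
  adj-sym (i , j , p , p<m , inj₂ ends) = i , j , p , p<m , inj₁ ends

  ascend : ∀ i j p e → p + e ≤ m → Walk G (pathAt i j p) (pathAt i j (p + e)) e
  ascend i j p zero _ = subst (λ q → Walk G (pathAt i j p) (pathAt i j q) 0) (sym (+-identityʳ p)) nil
  ascend i j p (suc e) p+e<m =
    cons (i , j , p , p<m , inj₁ (refl , refl))
         (subst (λ q → Walk G (pathAt i j (suc p)) (pathAt i j q) e) (sym (+-suc p e)) (ascend i j (suc p) e p+1+e≤m))
    where
    p+1+e≤m : suc p + e ≤ m
    p+1+e≤m = ≤-trans (≤-reflexive (sym (+-suc p e))) p+e<m
    p<m : p < m
    p<m = ≤-trans (s≤s (m≤m+n p e)) p+1+e≤m

  fromLeft : ∀ i j p → p ≤ m → Walk G (left i) (pathAt i j p) p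
  fromLeft i j p = ascend i j 0 p

  toRight : ∀ i j p → p ≤ m → Walk G (pathAt i j p) (right j) (m ∸ p)
  toRight i j p p≤m =
    subst (λ v → Walk G (pathAt i j p) v (m ∸ p)) (trans (cong (pathAt i j) (m+[n∸m]≡n p≤m)) (pathAt-right i j))
      (ascend i j p (m ∸ p) (≤-reflexive (m+[n∸m]≡n p≤m)))

  toLeft : ∀ i j p → p ≤ m → Walk G (pathAt i j p) (left i) p
  toLeft i j p p≤m = reverseWalk adj-sym (fromLeft i j p p≤m)

  fromRight : ∀ i j p → p ≤ m → Walk G (right j) (pathAt i j p) (m ∸ p)
  fromRight i j p p≤m = reverseWalk adj-sym (toRight i j p p≤m)

  along : ∀ i j p q → p ≤ m → q ≤ m → Walk G (pathAt i j p) (pathAt i j q) ∣ p - q ∣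
  along i j p q p≤m q≤m with ≤-total p q
  ... | inj₁ p≤q = subst₂ (λ r e → Walk G (pathAt i j p) (pathAt i j r) e) (m+[n∸m]≡n p≤q) (sym (m≤n⇒∣m-n∣≡n∸m p≤q))
                     (ascend i j p (q ∸ p) (≤-trans (≤-reflexive (m+[n∸m]≡n p≤q)) q≤m))
  ... | inj₂ q≤p = subst₂ (λ r e → Walk G (pathAt i j r) (pathAt i j q) e) (m+[n∸m]≡n q≤p) (sym (m≤n⇒∣n-m∣≡n∸m q≤p))
                     (reverseWalk adj-sym (ascend i j q (p ∸ q) (≤-trans (≤-reflexive (m+[n∸m]≡n q≤p)) p≤m)))

  record PathPotential : Set where
    field
      value     : Fin a → Fin b → ℕ → ℕ
      left-end  : ∀ i j j′ → value i j 0 ≡ value i j′ 0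
      right-end : ∀ i i′ j → value i j m ≡ value i′ j m
      steps     : ∀ i j p → p < m → value i j p ≈₁ value i j (suc p)

  module _ (P : PathPotential) where
    open PathPotential P

    atVertex : Vertex → ℕ
    atVertex v = value (leftIndex v) (rightIndex v) (level v)

    atVertex-path : ∀ i j p → p ≤ m → atVertex (pathAt i j p) ≡ value i j p
    atVertex-path i j zero _ = left-end i Fin.zero j
    atVertex-path i j (suc p) p≤m with suc p <? m
    ... | yes _  = cong (value i j ∘ suc) (toℕ-fromℕ< _)
    ... | no p≮m = trans (right-end Fin.zero i j) (cong (value i j) (≤-antisym (≮⇒≥ p≮m) p≤m))

    atVertex-Lipschitz : Lipschitz {G} atVertex
    atVertex-Lipschitz (i , j , p , p<m , inj₁ (refl , refl)) =
      subst₂ (λ x y → x ≤ suc y) (sym (atVertex-path i j (suc p) p<m)) (sym (atVertex-path i j p (<⇒≤ p<m)))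
        (proj₁ (steps i j p p<m))
    atVertex-Lipschitz (i , j , p , p<m , inj₂ (refl , refl)) =
      subst₂ (λ x y → x ≤ suc y) (sym (atVertex-path i j p (<⇒≤ p<m))) (sym (atVertex-path i j (suc p) p<m))
        (proj₂ (steps i j p p<m))

    distance-formula : ∀ p → atVertex p ≡ 0 → (∀ i j q → q ≤ m → Walk G p (pathAt i j q) (value i j q)) →
                       ∀ {v e} → Dist G p v e → e ≡ atVertex v
    distance-formula p p↦0 reach = distance-by-potential atVertex-Lipschitz p↦0 reach′
      where
      reach′ : ∀ v → Walk G p v (atVertex v)
      reach′ v = subst (λ w → Walk G p w (atVertex v)) (canonical v)
                   (reach (leftIndex v) (rightIndex v) (level v) (level≤m v))

  levelPotential : PathPotential
  levelPotential = record
    { value     = λ _ _ p → p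
    ; left-end  = λ _ _ _ → refl
    ; right-end = λ _ _ _ → refl
    ; steps     = λ _ _ p _ → ≤-refl , m≤n⇒m≤1+n (n≤1+n p)
    }

  level-Lipschitz : Lipschitz {G} level
  level-Lipschitz = atVertex-Lipschitz levelPotential

  common-path : ∀ i j p q → p ≤ m → q ≤ m →
    (level (pathAt i j p) < m → level (pathAt i j q) < m → leftIndex (pathAt i j p) ≡ leftIndex (pathAt i j q)) ×
    (0 < level (pathAt i j p) → 0 < level (pathAt i j q) → rightIndex (pathAt i j p) ≡ rightIndex (pathAt i j q))
  common-path i j p q p≤m q≤m with pathAt-coordinates i j p p≤m | pathAt-coordinates i j q q≤m
  ... | lp , ip , jp | lq , iq , jq =
    (λ p<m q<m → trans (ip (subst (_< m) lp p<m)) (sym (iq (subst (_< m) lq q<m)))) ,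
    (λ 0<p 0<q → trans (jp (subst (0 <_) lp 0<p)) (sym (jq (subst (0 <_) lq 0<q))))

  edge-indices : ∀ {u w} → Adj G u w →
    (level u < m → level w < m → leftIndex u ≡ leftIndex w) × (0 < level u → 0 < level w → rightIndex u ≡ rightIndex w)
  edge-indices (i , j , p , p<m , inj₁ (refl , refl)) = common-path i j p (suc p) (<⇒≤ p<m) p<m
  edge-indices (i , j , p , p<m , inj₂ (refl , refl)) = common-path i j (suc p) p p<m (<⇒≤ p<m)

-- Exchanging the two sides: position p on path (i , j) of K_{a,b}^{1/m} goes
-- to position m - p on path (j , i) of K_{b,a}^{1/m}.
swapVertex : ∀ {a b m} → KVertex a b m → KVertex b a m
swapVertex (left i)    = right i
swapVertex (right j)   = left j
swapVertex (mid i j t) = mid j i (Fin.opposite t)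

swapVertex-involutive : ∀ {a b m} (v : KVertex a b m) → swapVertex (swapVertex v) ≡ v
swapVertex-involutive (left i)    = refl
swapVertex-involutive (right j)   = refl
swapVertex-involutive (mid i j t) = cong (mid i j) (opposite-involutive t)

module Swap (a₁ b₁ k : ℕ) where
  module A = Structure a₁ b₁ k
  module B = Structure b₁ a₁ k
  open A using (m)

  swap-pathAt : ∀ i j p → p ≤ m → swapVertex (A.pathAt i j p) ≡ B.pathAt j i (m ∸ p)
  swap-pathAt i j p p≤m with m≤n⇒m<n∨m≡n p≤m
  ... | inj₂ refl = trans (cong swapVertex (A.pathAt-right i j)) (cong (B.pathAt j i) (sym (n∸n≡0 m)))
  swap-pathAt i j zero _ | inj₁ _ = sym (B.pathAt-right j i)
  swap-pathAt i j (suc p) _ | inj₁ 1+p<m = begin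
    swapVertex (A.pathAt i j (suc p))        ≡⟨ cong (λ q → swapVertex (A.pathAt i j (suc q))) (sym (toℕ-fromℕ< p<k)) ⟩
    swapVertex (A.pathAt i j (suc (toℕ t)))  ≡⟨ cong swapVertex (A.pathAt-mid i j t) ⟩
    mid j i (Fin.opposite t)                 ≡⟨ sym (B.pathAt-mid j i (Fin.opposite t)) ⟩
    B.pathAt j i (suc (toℕ (Fin.opposite t))) ≡⟨ cong (λ q → B.pathAt j i (suc q)) (opposite-prop t) ⟩
    B.pathAt j i (suc (k ∸ suc (toℕ t)))     ≡⟨ cong (λ q → B.pathAt j i (suc (k ∸ suc q))) (toℕ-fromℕ< p<k) ⟩
    B.pathAt j i (suc (k ∸ suc p))           ≡⟨ cong (B.pathAt j i) (sym (+-∸-assoc 1 p<k)) ⟩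
    B.pathAt j i (m ∸ suc p)                 ∎
    where
    open ≡-Reasoning
    p<k : p < k
    p<k = ≤-pred 1+p<m
    t : Fin k
    t = fromℕ< p<k

  swap-adj : ∀ {u w} → Adj A.G u w → Adj B.G (swapVertex u) (swapVertex w)
  swap-adj (i , j , p , p<m , ends) =
    j , i , m ∸ suc p , ∸-monoʳ-< (s≤s z≤n) p<m , swap-ends ends
    where
    near : swapVertex (A.pathAt i j p) ≡ B.pathAt j i (suc (m ∸ suc p))
    near = trans (swap-pathAt i j p (<⇒≤ p<m)) (cong (B.pathAt j i) (+-∸-assoc 1 p<m))
    far : swapVertex (A.pathAt i j (suc p)) ≡ B.pathAt j i (m ∸ suc p)
    far = swap-pathAt i j (suc p) p<m
    swap-ends : ∀ {u w} → (u ≡ A.pathAt i j p × w ≡ A.pathAt i j (suc p)) ⊎ (w ≡ A.pathAt i j p × u ≡ A.pathAt i j (suc p)) →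
                (swapVertex u ≡ B.pathAt j i (m ∸ suc p) × swapVertex w ≡ B.pathAt j i (suc (m ∸ suc p))) ⊎
                (swapVertex w ≡ B.pathAt j i (m ∸ suc p) × swapVertex u ≡ B.pathAt j i (suc (m ∸ suc p)))
    swap-ends (inj₁ (refl , refl)) = inj₂ (far , near)
    swap-ends (inj₂ (refl , refl)) = inj₁ (far , near)

swapSides : ∀ a₁ b₁ k → Isomorphism (KSub (suc a₁) (suc b₁) (suc k)) (KSub (suc b₁) (suc a₁) (suc k))
swapSides a₁ b₁ k = record
  { to       = swapVertex
  ; from     = swapVertex
  ; from-to  = swapVertex-involutive
  ; to-from  = swapVertex-involutive
  ; to-adj   = Swap.swap-adj a₁ b₁ k
  ; from-adj = Swap.swap-adj b₁ a₁ k
  }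

-- From here on m = n + 3 ≥ 3; s = m - 1 is the position next to the right end.
module Subdivided (a₁ b₁ n : ℕ) where
  open Structure a₁ b₁ (suc (suc n)) public

  s : ℕ
  s = suc (suc n)

  m∸s≡1 : m ∸ s ≡ 1
  m∸s≡1 = m+n∸n≡m 1 s

  -- What a probe answer tells the cop: the robber's level, and whether the
  -- robber is on a path through the probed left / right index.
  record Reading : Set where
    constructor reading
    field
      readLevel   : ℕ
      onLeftPath  : Bool
      onRightPath : Bool
  open Reading public

  LevelRead : Reading → Vertex → Set
  LevelRead o v = readLevel o ≡ level v

  LeftRead : Fin a → Reading → Vertex → Set
  LeftRead x o v = level v < m → Reflects (leftIndex v ≡ x) (onLeftPath o)

  RightRead : Fin b → Reading → Vertex → Set
  RightRead y o v = 0 < level v → Reflects (rightIndex v ≡ y) (onRightPath o)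

  -- Probing left x: on the paths leaving x the distance is the position p;
  -- elsewhere the shortest route runs through the right end of the path.
  leftValue : Bool → ℕ → ℕ
  leftValue true  p = p
  leftValue false p = m + (m ∸ p)

  leftValue-m : ∀ b → leftValue b m ≡ m
  leftValue-m true  = refl
  leftValue-m false = trans (cong (m +_) (n∸n≡0 m)) (+-identityʳ m)

  leftProbe : Fin a → PathPotential
  leftProbe x = record
    { value     = λ i j p → leftValue (does (i ≟ᶠ x)) p
    ; left-end  = λ _ _ _ → refl
    ; right-end = λ i i′ _ → trans (leftValue-m (does (i ≟ᶠ x))) (sym (leftValue-m (does (i′ ≟ᶠ x))))
    ; steps     = λ i j p → steps (does (i ≟ᶠ x)) p
    }
    where
    steps : ∀ b p → p < m → leftValue b p ≈₁ leftValue b (suc p)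
    steps true  p _   = ascending 0 p
    steps false p p<m = descending m m p p<m

  leftDistance : ∀ x {v e} → Dist G (left x) v e → e ≡ atVertex (leftProbe x) v
  leftDistance x = distance-formula (leftProbe x) (left x) (cong (λ b → leftValue b 0) (dec-true (x ≟ᶠ x) refl)) walks
    where
    walks : ∀ i j p → p ≤ m → Walk G (left x) (pathAt i j p) (leftValue (does (i ≟ᶠ x)) p)
    walks i j p p≤m with i ≟ᶠ x
    ... | yes refl = fromLeft x j p p≤m
    ... | no _     = toRight x j 0 z≤n ++ᵂ fromRight i j p p≤m

  -- answers below m come from the paths leaving x, larger ones from the others
  decodeLeft : ℕ → Reading
  decodeLeft d with d <? m
  ... | yes _ = reading d true false
  ... | no _  = reading (m ∸ (d ∸ m)) false false

  decodeLeft-inner : ∀ b p → p < m → decodeLeft (leftValue b p) ≡ reading p b false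
  decodeLeft-inner true p p<m with p <? m
  ... | yes _  = refl
  ... | no p≮m = contradiction p<m p≮m
  decodeLeft-inner false p p<m with m + (m ∸ p) <? m
  ... | yes too-small = contradiction too-small (m+n≮m m (m ∸ p))
  ... | no _ = cong (λ l → reading l false false) (trans (cong (m ∸_) (m+n∸m≡n m (m ∸ p))) (m∸[m∸n]≡n (<⇒≤ p<m)))

  decodeLeft-end : ∀ b → readLevel (decodeLeft (leftValue b m)) ≡ m
  decodeLeft-end b rewrite leftValue-m b with m <? m
  ... | yes m<m = contradiction m<m (<-irrefl refl)
  ... | no _    = cong (m ∸_) (n∸n≡0 m)

  decodeLeft-level : ∀ b p → p ≤ m → readLevel (decodeLeft (leftValue b p)) ≡ p
  decodeLeft-level b p p≤m with m≤n⇒m<n∨m≡n p≤m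
  ... | inj₁ p<m  = cong readLevel (decodeLeft-inner b p p<m)
  ... | inj₂ refl = decodeLeft-end b

  read-left : ∀ x v → let o = decodeLeft (atVertex (leftProbe x) v) in LevelRead o v × LeftRead x o v
  read-left x v =
    decodeLeft-level same (level v) (level≤m v) ,
    λ v<m → subst (Reflects _) (sym (cong onLeftPath (decodeLeft-inner same (level v) v<m))) (proof (leftIndex v ≟ᶠ x))
    where
    same : Bool
    same = does (leftIndex v ≟ᶠ x)

  -- Probing right y: on the paths into y the distance is m - p; elsewhere the
  -- shortest route runs through the left end of the path.
  rightValue : Bool → ℕ → ℕ
  rightValue true  p = m ∸ p
  rightValue false p = m + p

  rightValue-0 : ∀ b → rightValue b 0 ≡ m
  rightValue-0 true  = refl
  rightValue-0 false = +-identityʳ m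

  rightProbe : Fin b → PathPotential
  rightProbe y = record
    { value     = λ i j p → rightValue (does (j ≟ᶠ y)) p
    ; left-end  = λ _ j j′ → trans (rightValue-0 (does (j ≟ᶠ y))) (sym (rightValue-0 (does (j′ ≟ᶠ y))))
    ; right-end = λ _ _ _ → refl
    ; steps     = λ i j p → steps (does (j ≟ᶠ y)) p
    }
    where
    steps : ∀ b p → p < m → rightValue b p ≈₁ rightValue b (suc p)
    steps true  p p<m = descending 0 m p p<m
    steps false p _   = ascending m p

  rightDistance : ∀ y {v e} → Dist G (right y) v e → e ≡ atVertex (rightProbe y) v
  rightDistance y = distance-formula (rightProbe y) (right y) at-source walks
    where
    at-source : rightValue (does (y ≟ᶠ y)) m ≡ 0
    at-source = trans (cong (λ b → rightValue b m) (dec-true (y ≟ᶠ y) refl)) (n∸n≡0 m)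
    walks : ∀ i j p → p ≤ m → Walk G (right y) (pathAt i j p) (rightValue (does (j ≟ᶠ y)) p)
    walks i j p p≤m with j ≟ᶠ y
    ... | yes refl = fromRight i y p p≤m
    ... | no _     = fromRight i y 0 z≤n ++ᵂ fromLeft i j p p≤m

  -- answers up to m come from the paths into y (or from a left vertex), larger ones from the others
  decodeRight : ℕ → Reading
  decodeRight d with d ≤? m
  ... | yes _ = reading (m ∸ d) false true
  ... | no _  = reading (d ∸ m) false false

  decodeRight-inner : ∀ b p → 0 < p → p ≤ m → decodeRight (rightValue b p) ≡ reading p false b
  decodeRight-inner true p _ p≤m with m ∸ p ≤? m
  ... | yes _ = cong (λ l → reading l false true) (m∸[m∸n]≡n p≤m)
  ... | no ≰m = contradiction (m∸n≤m m p) ≰m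
  decodeRight-inner false p 0<p _ with m + p ≤? m
  ... | yes too-big = contradiction too-big (<⇒≱ (m<m+n m 0<p))
  ... | no _        = cong (λ l → reading l false false) (m+n∸m≡n m p)

  decodeRight-end : ∀ b → readLevel (decodeRight (rightValue b 0)) ≡ 0
  decodeRight-end b rewrite rightValue-0 b with m ≤? m
  ... | yes _ = n∸n≡0 m
  ... | no ≰m = contradiction ≤-refl ≰m

  decodeRight-level : ∀ b p → p ≤ m → readLevel (decodeRight (rightValue b p)) ≡ p
  decodeRight-level b zero    _   = decodeRight-end b
  decodeRight-level b (suc p) p≤m = cong readLevel (decodeRight-inner b (suc p) (s≤s z≤n) p≤m)

  read-right : ∀ y v → let o = decodeRight (atVertex (rightProbe y) v) in LevelRead o v × RightRead y o v
  read-right y v =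
    decodeRight-level same (level v) (level≤m v) ,
    λ 0<v → subst (Reflects _) (sym (cong onRightPath (decodeRight-inner same (level v) 0<v (level≤m v)))) (proof (rightIndex v ≟ᶠ y))
    where
    same : Bool
    same = does (rightIndex v ≟ᶠ y)

  -- This is used right after the robber has been seen on a right vertex, so
  -- it only has to be read for robbers at level s or m.
  nearValue : Bool → Bool → ℕ → ℕ
  nearValue true  true  p = ∣ s - p ∣
  nearValue true  false p = s + p
  nearValue false true  p = suc (m ∸ p)
  nearValue false false p = (suc m + p) ⊓ (s + m + (m ∸ p))

  nearLeftEnd : Bool → ℕ
  nearLeftEnd true  = s
  nearLeftEnd false = suc m

  nearRightEnd : Bool → ℕ
  nearRightEnd true  = 1
  nearRightEnd false = s + m

  nearValue-0 : ∀ bi bj → nearValue bi bj 0 ≡ nearLeftEnd bi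
  nearValue-0 true  true  = refl
  nearValue-0 true  false = +-identityʳ s
  nearValue-0 false true  = refl
  nearValue-0 false false = trans (m≤n⇒m⊓n≡m 1+m+0≤) (+-identityʳ (suc m))
    where
    1+m+0≤ : suc m + 0 ≤ s + m + m
    1+m+0≤ = ≤-trans (≤-reflexive (+-identityʳ (suc m))) (≤-trans (+-monoˡ-≤ m {1} {s} (s≤s z≤n)) (m≤m+n (s + m) m))

  nearValue-m : ∀ bi bj → nearValue bi bj m ≡ nearRightEnd bj
  nearValue-m true  true  = trans (m≤n⇒∣m-n∣≡n∸m (n≤1+n s)) m∸s≡1
  nearValue-m true  false = refl
  nearValue-m false true  = cong suc (n∸n≡0 m)
  nearValue-m false false =
    trans (cong ((suc m + m) ⊓_) (trans (cong (s + m +_) (n∸n≡0 m)) (+-identityʳ (s + m))))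
          (m≥n⇒m⊓n≡n (+-monoˡ-≤ m (m≤n⇒m≤1+n (n≤1+n s))))

  nearProbe : Fin a → Fin b → PathPotential
  nearProbe x y = record
    { value     = λ i j p → nearValue (does (i ≟ᶠ x)) (does (j ≟ᶠ y)) p
    ; left-end  = λ i j j′ → trans (nearValue-0 (does (i ≟ᶠ x)) (does (j ≟ᶠ y))) (sym (nearValue-0 (does (i ≟ᶠ x)) (does (j′ ≟ᶠ y))))
    ; right-end = λ i i′ j → trans (nearValue-m (does (i ≟ᶠ x)) _) (sym (nearValue-m (does (i′ ≟ᶠ x)) _))
    ; steps     = λ i j p → steps (does (i ≟ᶠ x)) (does (j ≟ᶠ y)) p
    }
    where
    steps : ∀ bi bj p → p < m → nearValue bi bj p ≈₁ nearValue bi bj (suc p)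
    steps true  true  p _   = distance-step s p
    steps true  false p _   = ascending s p
    steps false true  p p<m = descending 1 m p p<m
    steps false false p p<m = ≈₁-⊓ (ascending (suc m) p) (descending (s + m) m p p<m)

  nearDistance : ∀ x y {v e} → Dist G (pathAt x y s) v e → e ≡ atVertex (nearProbe x y) v
  nearDistance x y = distance-formula (nearProbe x y) (pathAt x y s) at-source walks
    where
    s≤m : s ≤ m
    s≤m = n≤1+n s
    at-source : atVertex (nearProbe x y) (pathAt x y s) ≡ 0
    at-source = begin
      atVertex (nearProbe x y) (pathAt x y s)            ≡⟨ atVertex-path (nearProbe x y) x y s s≤m ⟩
      nearValue (does (x ≟ᶠ x)) (does (y ≟ᶠ y)) s         ≡⟨ cong₂ (λ bi bj → nearValue bi bj s) (dec-true (x ≟ᶠ x) refl) (dec-true (y ≟ᶠ y) refl) ⟩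
      ∣ s - s ∣                                            ≡⟨ ∣n-n∣≡0 s ⟩
      0                                                    ∎
      where open ≡-Reasoning
    s→right : ∀ {i j} → Walk G (pathAt i j s) (right j) 1
    s→right = subst (Walk G _ _) m∸s≡1 (toRight _ _ s s≤m)
    walks : ∀ i j p → p ≤ m → Walk G (pathAt x y s) (pathAt i j p) (nearValue (does (i ≟ᶠ x)) (does (j ≟ᶠ y)) p)
    walks i j p p≤m with i ≟ᶠ x | j ≟ᶠ y
    ... | yes refl | yes refl = along x y s p s≤m p≤m
    ... | yes refl | no _     = toLeft x y s s≤m ++ᵂ fromLeft x j p p≤m
    ... | no _     | yes refl = s→right ++ᵂ fromRight i y p p≤m
    ... | no _     | no _     =
      shorter (s→right ++ᵂ fromRight i y 0 z≤n ++ᵂ fromLeft i j p p≤m)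
              (subst (Walk G _ _) (sym (+-assoc s m (m ∸ p))) (toLeft x y s s≤m ++ᵂ toRight x j 0 z≤n ++ᵂ fromRight i j p p≤m))

  nearTable : Bool → ℕ → Reading
  nearTable onRight zero          = reading s true onRight
  nearTable onRight (suc zero)    = reading m false onRight
  nearTable onRight (suc (suc _)) = reading s false onRight

  -- at levels s and m the possible answers are 0, 1, 2 on paths into y and
  -- 2s, 2s + 1, 2s + 2 on the other paths
  decodeNear : ℕ → Reading
  decodeNear d with d <? 3
  ... | yes _ = nearTable true d
  ... | no _  = nearTable false (d ∸ (s + s))

  3≤s+s : 3 ≤ s + s
  3≤s+s = s≤s (s≤s (≤-trans (s≤s z≤n) (m≤n+m (suc (suc n)) n)))

  decodeNear-large : ∀ c → decodeNear (c + (s + s)) ≡ nearTable false c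
  decodeNear-large c with c + (s + s) <? 3
  ... | yes small = contradiction small (≤⇒≯ (≤-trans 3≤s+s (m≤n+m (s + s) c)))
  ... | no _ = cong (nearTable false) (m+n∸n≡m c (s + s))

  nearValue-far : nearValue false false s ≡ 2 + (s + s)
  nearValue-far = m≤n⇒m⊓n≡m (≤-reflexive (sym (begin
    s + m + (m ∸ s)  ≡⟨ cong (s + m +_) m∸s≡1 ⟩
    s + m + 1        ≡⟨ +-comm (s + m) 1 ⟩
    suc (s + suc s)  ≡⟨ cong suc (+-suc s s) ⟩
    2 + (s + s)      ∎)))
    where open ≡-Reasoning

  nearValue-s : ∀ bi bj → decodeNear (nearValue bi bj s) ≡ reading s bi bj
  nearValue-s true  true  = cong decodeNear (∣n-n∣≡0 s)
  nearValue-s true  false = decodeNear-large 0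
  nearValue-s false true  = cong (decodeNear ∘ suc) m∸s≡1
  nearValue-s false false = trans (cong decodeNear nearValue-far) (decodeNear-large 2)

  nearValue-at-m : ∀ bi bj → decodeNear (nearValue bi bj m) ≡ reading m false bj
  nearValue-at-m bi true  = cong decodeNear (nearValue-m bi true)
  nearValue-at-m bi false = trans (cong decodeNear (trans (nearValue-m bi false) (+-suc s s))) (decodeNear-large 1)

  read-near : ∀ x y v → s ≤ level v →
              let o = decodeNear (atVertex (nearProbe x y) v) in LevelRead o v × LeftRead x o v × RightRead y o v
  read-near x y (left _) ()
  read-near x y (right j) _ rewrite nearValue-at-m (does (Fin.zero ≟ᶠ x)) (does (j ≟ᶠ y)) =
    refl , (λ m<m → contradiction m<m (<-irrefl refl)) , λ _ → proof (j ≟ᶠ y)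
  read-near x y (mid i j t) s≤v rewrite ≤-antisym (toℕ<n t) s≤v =
    cong readLevel agrees ,
    (λ _ → subst (Reflects _) (sym (cong onLeftPath agrees)) (proof (i ≟ᶠ x))) ,
    (λ _ → subst (Reflects _) (sym (cong onRightPath agrees)) (proof (j ≟ᶠ y)))
    where
    agrees : decodeNear (nearValue (does (i ≟ᶠ x)) (does (j ≟ᶠ y)) s) ≡ reading s (does (i ≟ᶠ x)) (does (j ≟ᶠ y))
    agrees = nearValue-s (does (i ≟ᶠ x)) (does (j ≟ᶠ y))

module Cop (a₁ b₁ n : ℕ) where
  open Subdivided a₁ b₁ n

  record State : Set where
    constructor state
    field
      lastLevel   : ℕ
      leftSearch  : Search
      rightSearch : Search
  open State

  start : State
  start = state 0 (atLeast 0) (atLeast 0)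

  leftTodo rightTodo : State → ℕ
  leftTodo q  = remaining a₁ (leftSearch q)
  rightTodo q = remaining b₁ (rightSearch q)

  leftGuess : State → Fin a
  leftGuess q = clamp a₁ (current (leftSearch q))

  rightGuess : State → Fin b
  rightGuess q = clamp b₁ (current (rightSearch q))

  -- Phases: search the left index by probing left vertices; once it is known,
  -- search the right index by probing right vertices; and right after the
  -- robber was seen at a right vertex, probe next to that vertex.
  data Phase : Set where
    seekLeft seekRight leaveRight : Phase

  data PhaseView (q : State) : Phase → Set where
    at-right    : lastLevel q ≡ m → PhaseView q leaveRight
    left-known  : lastLevel q ≢ m → leftTodo q ≡ 0 → PhaseView q seekRight
    left-open   : lastLevel q ≢ m → leftTodo q ≢ 0 → PhaseView q seekLeft

  classify : (q : State) → Σ Phase (PhaseView q)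
  classify q with lastLevel q ≟ m | leftTodo q ≟ 0
  ... | yes at-m | _          = leaveRight , at-right at-m
  ... | no below | yes known  = seekRight , left-known below known
  ... | no below | no unknown = seekLeft , left-open below unknown

  phase : State → Phase
  phase q = proj₁ (classify q)

  probeIn : Phase → State → Vertex
  probeIn seekLeft   q = left (leftGuess q)
  probeIn seekRight  q = right (rightGuess q)
  probeIn leaveRight q = pathAt Fin.zero (rightGuess q) s

  decodeIn : Phase → ℕ → Reading
  decodeIn seekLeft   = decodeLeft
  decodeIn seekRight  = decodeRight
  decodeIn leaveRight = decodeNear

  -- a search is restarted when the robber reaches the end of the paths at
  -- which its index stops being meaningful
  resetAt : ℕ → ℕ → Search → Search
  resetAt end l c with l ≟ end
  ... | yes _ = atLeast 0
  ... | no _  = c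

  resetAt-fits : ∀ {N} end l c {z : Fin (suc N)} → (l ≢ end → Fits c z) → Fits (resetAt end l c) z
  resetAt-fits end l c fits with l ≟ end
  ... | yes _   = start-fits _
  ... | no l≢end = fits l≢end

  resetAt-keeps : ∀ {end l} c → l ≢ end → resetAt end l c ≡ c
  resetAt-keeps {end} {l} c l≢end with l ≟ end
  ... | yes l≡end = contradiction l≡end l≢end
  ... | no _      = refl

  resetAt-end : ∀ end c → resetAt end end c ≡ atLeast 0
  resetAt-end end c with end ≟ end
  ... | yes _ = refl
  ... | no ≢  = contradiction refl ≢

  nextLeft : Phase → State → Bool → Search
  nextLeft seekLeft   q b = refine (leftSearch q) b
  nextLeft seekRight  q _ = leftSearch q
  nextLeft leaveRight q b = refine (atLeast 0) b

  nextRight : Phase → State → Bool → Search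
  nextRight seekLeft   q _ = rightSearch q
  nextRight seekRight  q b = refine (rightSearch q) b
  nextRight leaveRight q b = refine (rightSearch q) b

  update : Phase → State → Reading → State
  update k q o = state (readLevel o)
                       (resetAt m (readLevel o) (nextLeft k q (onLeftPath o)))
                       (resetAt 0 (readLevel o) (nextRight k q (onRightPath o)))

  step : State → ℕ → State
  step q d = update (phase q) q (decodeIn (phase q) d)

  probe : State → Vertex
  probe q = probeIn (phase q) q

  open Automaton {G = G} start step probe public

  record Consistent (q : State) (v : Vertex) : Set where
    field
      level-known : lastLevel q ≡ level v
      left-fits   : level v < m → Fits (leftSearch q) (leftIndex v)
      right-fits  : 0 < level v → Fits (rightSearch q) (rightIndex v)
      right-fresh : lastLevel q ≡ 0 → rightSearch q ≡ atLeast 0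

  record Carried (q : State) (v : Vertex) : Set where
    field
      left-carried  : lastLevel q ≢ m → level v < m → Fits (leftSearch q) (leftIndex v)
      right-carried : 0 < level v → Fits (rightSearch q) (rightIndex v)
      level-carried : lastLevel q ≤ suc (level v)

  carried-start : ∀ v → Carried start v
  carried-start v = record { left-carried = λ _ _ → start-fits _ ; right-carried = λ _ → start-fits _ ; level-carried = z≤n }

  -- A move keeps the robber on its path unless it passes through an end of
  -- it, where the corresponding search is either unused (level m) or restarted (level 0).
  carried-move : ∀ {q v v′} → Consistent q v → (v′ ≡ v) ⊎ Adj G v v′ → Carried q v′
  carried-move {q} {v} c (inj₁ refl) = record
    { left-carried  = λ _ → left-fits
    ; right-carried = right-fits
    ; level-carried = ≤-trans (≤-reflexive level-known) (n≤1+n (level v))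
    }
    where open Consistent c
  carried-move {q} {v} {v′} c (inj₂ edge) = record
    { left-carried  = λ below v′<m →
        subst (Fits (leftSearch q)) (proj₁ (edge-indices edge) (v<m below) v′<m) (left-fits (v<m below))
    ; right-carried = right-carried
    ; level-carried = ≤-trans (≤-reflexive level-known) (level-Lipschitz (adj-sym edge))
    }
    where
    open Consistent c
    v<m : lastLevel q ≢ m → level v < m
    v<m below = ≤∧≢⇒< (level≤m v) (λ v≡m → below (trans level-known v≡m))
    right-carried : 0 < level v′ → Fits (rightSearch q) (rightIndex v′)
    right-carried 0<v′ with level v ≟ 0
    ... | yes v≡0 = subst (λ c → Fits c (rightIndex v′)) (sym (right-fresh (trans level-known v≡0))) (start-fits _)
    ... | no v≢0  = subst (Fits (rightSearch q)) (proj₂ (edge-indices edge) (n≢0⇒n>0 v≢0) 0<v′) (right-fits (n≢0⇒n>0 v≢0))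

  update-consistent : ∀ k q o v → LevelRead o v →
                      (level v < m → Fits (nextLeft k q (onLeftPath o)) (leftIndex v)) →
                      (0 < level v → Fits (nextRight k q (onRightPath o)) (rightIndex v)) →
                      Consistent (update k q o) v
  update-consistent k q o v level-read left-ok right-ok = record
    { level-known = level-read
    ; left-fits   = λ v<m → resetAt-fits m (readLevel o) _ (λ _ → left-ok v<m)
    ; right-fits  = λ 0<v → resetAt-fits 0 (readLevel o) _ (λ _ → right-ok 0<v)
    ; right-fresh = λ l≡0 → subst (λ l → resetAt 0 l next ≡ atLeast 0) (sym l≡0) (resetAt-end 0 next)
    }
    where
    next : Search
    next = nextRight k q (onRightPath o)

  leaving-right : ∀ {q v} → lastLevel q ≡ m → Carried q v → s ≤ level v
  leaving-right at-m carried = ≤-pred (≤-trans (≤-reflexive (sym at-m)) (Carried.level-carried carried))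

  round : ∀ {q k v e} → PhaseView q k → Carried q v → Dist G (probeIn k q) v e → Consistent (update k q (decodeIn k e)) v
  round {q} {v = v} (at-right at-m) carried dist rewrite nearDistance Fin.zero (rightGuess q) dist
    with read-near Fin.zero (rightGuess q) v (leaving-right at-m carried)
  ... | level-read , left-read , right-read =
    update-consistent leaveRight q (decodeNear (atVertex (nearProbe Fin.zero (rightGuess q)) v)) v level-read
      (λ v<m → refine-fits (atLeast 0) (start-fits _) (left-read v<m))
      (λ 0<v → refine-fits (rightSearch q) (Carried.right-carried carried 0<v) (right-read 0<v))
  round {q} {v = v} (left-known below _) carried dist rewrite rightDistance (rightGuess q) dist
    with read-right (rightGuess q) v
  ... | level-read , right-read =
    update-consistent seekRight q (decodeRight (atVertex (rightProbe (rightGuess q)) v)) v level-read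
      (Carried.left-carried carried below)
      (λ 0<v → refine-fits (rightSearch q) (Carried.right-carried carried 0<v) (right-read 0<v))
  round {q} {v = v} (left-open below _) carried dist rewrite leftDistance (leftGuess q) dist
    with read-left (leftGuess q) v
  ... | level-read , left-read =
    update-consistent seekLeft q (decodeLeft (atVertex (leftProbe (leftGuess q)) v)) v level-read
      (λ v<m → refine-fits (leftSearch q) (Carried.left-carried carried below v<m) (left-read v<m))
      (Carried.right-carried carried)

  open Invariant Consistent Carried carried-start carried-move (λ {q} → round (proj₂ (classify q)))

  Pinned : State → Set
  Pinned q = (lastLevel q < m → leftTodo q ≡ 0) × (0 < lastLevel q → rightTodo q ≡ 0)

  pinned? : ∀ q → Dec (Pinned q)
  pinned? q = ((lastLevel q <? m) →-dec (leftTodo q ≟ 0)) ×-dec ((0 <? lastLevel q) →-dec (rightTodo q ≟ 0))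

  pinned-unique : ∀ {q v v′} → Pinned q → Consistent q v → Consistent q v′ → v ≡ v′
  pinned-unique {q} {v} {v′} (left-done , right-done) c c′ = vertex-ext same-level
    (λ v<m → finished (leftSearch q) (left-done (at-level v<m)) (left-fits c v<m) (left-fits c′ (subst (_< m) same-level v<m)))
    (λ 0<v → finished (rightSearch q) (right-done (at-level 0<v)) (right-fits c 0<v) (right-fits c′ (subst (0 <_) same-level 0<v)))
    where
    open Consistent
    same-level : level v ≡ level v′
    same-level = trans (sym (level-known c)) (level-known c′)
    at-level : ∀ {P : ℕ → Set} → P (level v) → P (lastLevel q)
    at-level {P} = subst P (sym (level-known c))

  -- Schedule invariant: while the robber is below level m, either the left
  -- search will finish before the robber can reach a left vertex, or the cop
  -- is still in its initial sweep, which has taken t rounds so far.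
  OnSchedule : ℕ → State → Set
  OnSchedule t q = lastLevel q < m → leftTodo q ≤ lastLevel q ⊎ leftTodo q + t ≤ a₁

  schedule-start : OnSchedule 0 start
  schedule-start _ = inj₂ (≤-reflexive (+-identityʳ a₁))

  -- a search restarted next to a right vertex has at most s candidates left
  -- (this is where a ≤ m + 1 is needed)
  fresh-search : a₁ ≤ m → ∀ b → remaining a₁ (refine (atLeast 0) b) ≤ s
  fresh-search _     true  = z≤n
  fresh-search a₁≤m false = ∸-monoˡ-≤ 1 a₁≤m

  schedule-step : a₁ ≤ m → ∀ {q k} t o → PhaseView q k → lastLevel q ≤ m → lastLevel q ≤ suc (readLevel o) →
                  OnSchedule t q → OnSchedule (suc t) (update k q o)
  schedule-step a₁≤m {q} {k} t o view bounded dropped on-time l<m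
    rewrite resetAt-keeps {m} (nextLeft k q (onLeftPath o)) (<⇒≢ l<m) = go view
    where
    l : ℕ
    l = readLevel o
    go : PhaseView q k → remaining a₁ (nextLeft k q (onLeftPath o)) ≤ l ⊎ remaining a₁ (nextLeft k q (onLeftPath o)) + suc t ≤ a₁
    go (at-right at-m) = inj₁ (≤-trans (fresh-search a₁≤m (onLeftPath o)) (≤-pred (subst (_≤ suc l) at-m dropped)))
    go (left-known _ known) = inj₁ (≤-trans (≤-reflexive known) z≤n)
    go (left-open below unknown) = catch-up (on-time (≤∧≢⇒< bounded below))
      where
      shrink : suc (remaining a₁ (refine (leftSearch q) (onLeftPath o))) ≤ leftTodo q
      shrink = refine-shrinks a₁ (leftSearch q) (onLeftPath o) unknown
      catch-up : leftTodo q ≤ lastLevel q ⊎ leftTodo q + t ≤ a₁ →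
                 remaining a₁ (refine (leftSearch q) (onLeftPath o)) ≤ l ⊎ remaining a₁ (refine (leftSearch q) (onLeftPath o)) + suc t ≤ a₁
      catch-up (inj₁ todo≤level) = inj₁ (≤-pred (≤-trans shrink (≤-trans todo≤level dropped)))
      catch-up (inj₂ todo+t≤a₁)  = inj₂ (≤-trans (≤-reflexive (+-suc _ t)) (≤-trans (+-monoˡ-≤ t shrink) todo+t≤a₁))

  -- Progress measure: the right search dominates; the left search only counts
  -- below level m (at level m it is about to be restarted).
  leftMeasure : State → ℕ
  leftMeasure q with lastLevel q ≟ m
  ... | yes _ = 0
  ... | no _  = leftTodo q

  measure : State → ℕ
  measure q = rightTodo q * a + leftMeasure q

  leftMeasure-at-m : ∀ q → lastLevel q ≡ m → leftMeasure q ≡ 0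
  leftMeasure-at-m q at-m with lastLevel q ≟ m
  ... | yes _    = refl
  ... | no below = contradiction at-m below

  leftMeasure-below : ∀ q → lastLevel q ≢ m → leftMeasure q ≡ leftTodo q
  leftMeasure-below q below with lastLevel q ≟ m
  ... | yes at-m = contradiction at-m below
  ... | no _     = refl

  leftMeasure≤ : ∀ q → leftMeasure q ≤ a₁
  leftMeasure≤ q with lastLevel q ≟ m
  ... | yes _ = z≤n
  ... | no _  = remaining≤ a₁ (leftSearch q)

  measure≤ : ∀ q → measure q ≤ b₁ * a + a₁
  measure≤ q = +-mono-≤ (*-monoˡ-≤ a (remaining≤ b₁ (rightSearch q))) (leftMeasure≤ q)

  measure-right : ∀ q q′ → rightTodo q′ < rightTodo q → measure q′ < measure q
  measure-right q q′ shrinks = begin-strict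
    rightTodo q′ * a + leftMeasure q′  ≤⟨ +-monoʳ-≤ (rightTodo q′ * a) (leftMeasure≤ q′) ⟩
    rightTodo q′ * a + a₁              <⟨ +-monoʳ-< (rightTodo q′ * a) (n<1+n a₁) ⟩
    rightTodo q′ * a + a               ≡⟨ +-comm (rightTodo q′ * a) a ⟩
    suc (rightTodo q′) * a             ≤⟨ *-monoˡ-≤ a shrinks ⟩
    rightTodo q * a                    ≤⟨ m≤m+n (rightTodo q * a) (leftMeasure q) ⟩
    measure q                          ∎
    where open ≤-Reasoning

  measure-left : ∀ q q′ → rightTodo q′ ≡ rightTodo q → leftMeasure q′ < leftMeasure q → measure q′ < measure q
  measure-left q q′ same shrinks rewrite same = +-monoʳ-< (rightTodo q * a) shrinks

  progress : ∀ {q k} t o → PhaseView q k → ¬ Pinned q → lastLevel q ≤ suc (readLevel o) →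
             OnSchedule t (update k q o) → a₁ < t → Pinned (update k q o) ⊎ measure (update k q o) < measure q
  progress {q} t o (at-right at-m) unpinned dropped _ _ =
    inj₂ (measure-right q (update leaveRight q o)
           (subst (λ c → remaining b₁ c < rightTodo q) (sym (resetAt-keeps (refine (rightSearch q) (onRightPath o)) (>⇒≢ 0<l)))
                               (refine-shrinks b₁ (rightSearch q) (onRightPath o) right-open)))
    where
    right-open : rightTodo q ≢ 0
    right-open done = unpinned ((λ l<m → contradiction at-m (<⇒≢ l<m)) , λ _ → done)
    0<l : 0 < readLevel o
    0<l = ≤-trans (s≤s z≤n) (≤-pred (subst (_≤ suc (readLevel o)) at-m dropped))
  progress {q} t o (left-known below known) unpinned _ _ _ = by-level (readLevel o ≟ 0)
    where
    right-open : rightTodo q ≢ 0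
    right-open done = unpinned ((λ _ → known) , λ _ → done)
    by-level : Dec (readLevel o ≡ 0) → Pinned (update seekRight q o) ⊎ measure (update seekRight q o) < measure q
    by-level (yes l≡0) =
      inj₁ ((λ _ → trans (cong (remaining a₁) (resetAt-keeps (leftSearch q) (λ l≡m → 0≢1+n (trans (sym l≡0) l≡m)))) known) ,
            λ 0<l → contradiction l≡0 (>⇒≢ 0<l))
    by-level (no l≢0) =
      inj₂ (measure-right q (update seekRight q o)
             (subst (λ c → remaining b₁ c < rightTodo q) (sym (resetAt-keeps (refine (rightSearch q) (onRightPath o)) l≢0))
                    (refine-shrinks b₁ (rightSearch q) (onRightPath o) right-open)))
  progress {q} t o (left-open below unknown) unpinned _ on-time late = by-level (readLevel o ≟ 0)
    where
    -- at a left vertex the schedule forces the left search to be finished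
    caught : ∀ {r} → readLevel o ≡ 0 → r ≤ readLevel o ⊎ r + t ≤ a₁ → r ≡ 0
    caught l≡0 (inj₁ r≤l)   = n≤0⇒n≡0 (subst (_ ≤_) l≡0 r≤l)
    caught l≡0 (inj₂ r+t≤a) = contradiction (≤-trans (m≤n+m t _) r+t≤a) (<⇒≱ late)
    left-shrinks : Dec (readLevel o ≡ m) → leftMeasure (update seekLeft q o) < leftTodo q
    left-shrinks (yes l≡m) = subst (_< leftTodo q) (sym (leftMeasure-at-m _ l≡m)) (n≢0⇒n>0 unknown)
    left-shrinks (no l≢m)  =
      subst (_< leftTodo q) (sym (trans (leftMeasure-below _ l≢m) (cong (remaining a₁) (resetAt-keeps (refine (leftSearch q) (onLeftPath o)) l≢m))))
            (refine-shrinks a₁ (leftSearch q) (onLeftPath o) unknown)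
    by-level : Dec (readLevel o ≡ 0) → Pinned (update seekLeft q o) ⊎ measure (update seekLeft q o) < measure q
    by-level (yes l≡0) = inj₁ ((λ l<m → caught l≡0 (on-time l<m)) , λ 0<l → contradiction l≡0 (>⇒≢ 0<l))
    by-level (no l≢0)  =
      inj₂ (measure-left q (update seekLeft q o) (cong (remaining b₁) (resetAt-keeps (rightSearch q) l≢0))
             (subst (leftMeasure (update seekLeft q o) <_) (sym (leftMeasure-below q below)) (left-shrinks (readLevel o ≟ m))))

  module Along (few-left : a₁ ≤ m) {r : ℕ → Vertex} {d : ℕ → ℕ} (play : Play G strategy r d) where

    S : ℕ → State
    S = stateAt d

    consistent : ∀ t → Consistent (S (suc t)) (r t)
    consistent = consistent-play play

    level-bounded : ∀ t → lastLevel (S t) ≤ m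
    level-bounded zero    = z≤n
    level-bounded (suc t) = subst (_≤ m) (sym (Consistent.level-known (consistent t))) (level≤m (r t))

    level-drop : ∀ t → lastLevel (S t) ≤ suc (lastLevel (step (S t) (d t)))
    level-drop zero    = z≤n
    level-drop (suc t) = subst (λ q → lastLevel (S (suc t)) ≤ suc (lastLevel q)) (stateAt-suc d (suc t))
      (≤-trans (Carried.level-carried (carried-move (consistent t) (proj₁ play t)))
               (s≤s (≤-reflexive (sym (Consistent.level-known (consistent (suc t)))))))

    on-schedule : ∀ t → OnSchedule t (S t)
    on-schedule zero    = schedule-start
    on-schedule (suc t) = subst (OnSchedule (suc t)) (sym (stateAt-suc d t))
      (schedule-step few-left t (decodeIn (phase (S t)) (d t)) (proj₂ (classify (S t)))
                     (level-bounded t) (level-drop t) (on-schedule t))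

    advancing : ∀ t → a₁ ≤ t → ¬ Pinned (S (suc t)) → Pinned (S (suc (suc t))) ⊎ measure (S (suc (suc t))) < measure (S (suc t))
    advancing t a₁≤t unpinned = subst (λ q → Pinned q ⊎ measure q < measure (S (suc t))) (sym (stateAt-suc d (suc t)))
      (progress (suc (suc t)) (decodeIn (phase (S (suc t))) (d (suc t))) (proj₂ (classify (S (suc t)))) unpinned
                (level-drop (suc t)) (subst (OnSchedule (suc (suc t))) (stateAt-suc d (suc t)) (on-schedule (suc (suc t))))
                (s≤s (m≤n⇒m≤1+n a₁≤t)))

  locatable : a₁ ≤ m → Locatable G
  locatable few-left = strategy , a₁ + suc (b₁ * a + a₁) , wins
    where
    wins : ∀ r d → Play G strategy r d → Σ ℕ λ w → w ≤ a₁ + suc (b₁ * a + a₁) × Located G strategy r d w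
    wins r d play = finish (descent (λ t → Pinned (S (suc t))) (λ t → pinned? (S (suc t))) (λ t → measure (S (suc t))) a₁ advancing)
      where
      open Along few-left play
      finish : (Σ ℕ λ w → w ≤ a₁ + suc (measure (S (suc a₁))) × Pinned (S (suc w))) →
               Σ ℕ λ w → w ≤ a₁ + suc (b₁ * a + a₁) × Located G strategy r d w
      finish (w , w≤ , pinned) = w , ≤-trans w≤ (+-monoʳ-≤ a₁ (s≤s (measure≤ (S (suc a₁))))) , located play w (pinned-unique pinned)

mainTheorem8 : (a b m : ℕ) → 3 ≤ a → 3 ≤ b → (a ⊓ b) ∸ 1 ≤ m → 3 ≤ m →
                 Locatable (KSub a b m)
mainTheorem8 (suc a₁) (suc b₁) m@(suc k@(suc (suc n))) (s≤s _) (s≤s _) smaller≤m (s≤s (s≤s (s≤s _))) with ⊓-sel a₁ b₁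
... | inj₁ left-smaller  = Cop.locatable a₁ b₁ n (subst (_≤ m) left-smaller smaller≤m)
... | inj₂ right-smaller = locatable-transfer (swapSides a₁ b₁ k) (Cop.locatable b₁ a₁ n (subst (_≤ m) right-smaller smaller≤m))
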